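{- Let $k\geq 2$ be an integer and let $n=F_{2k+3}-1$. Then the Fibonacci-sum graph $G_n$ contains a cycle of length $2k$.
   Context: The Fibonacci numbers are defined by $F_0=0$, $F_1=1$ and $F_m=F_{m-1}+F_{m-2}$ for $m\geq 2$. For each integer $n\geq 1$, the Fibonacci-sum graph $G_n$ is the simple graph with vertex set $\{1,2,\dots,n\}$ in which distinct vertices $i,j$ are adjacent if and only if $i+j$ is a Fibonacci number. -}

module Defs where

open import Data.Nat using (ℕ; zero; suc; _+_; _≤_)
open import Data.Fin using (Fin; toℕ; fromℕ<)
open import Data.Nat.DivMod using (_%_; m%n<n)
open import Data.Product using (∃; _×_)
open import Relation.Binary.PropositionalEquality using (_≡_; _≢_)
open import Relation.Nullary using (¬_)
open import Function.Definitions using (Injective)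

fib : ℕ → ℕ
fib zero = 0
fib (suc zero) = 1
fib (suc (suc m)) = fib (suc m) + fib m

IsFib : ℕ → Set
IsFib m = ∃ λ i → fib i ≡ m

IsVertex : ℕ → ℕ → Set
IsVertex n i = 1 ≤ i × i ≤ n

Adj : ℕ → ℕ → ℕ → Set
Adj n i j = IsVertex n i × IsVertex n j × i ≢ j × IsFib (i + j)

csuc : ∀ {L} → Fin L → Fin L
csuc {suc L} i = fromℕ< (m%n<n (suc (toℕ i)) (suc L))

HasCycle : ℕ → ℕ → Set
HasCycle n L = 3 ≤ L × ∃ λ (v : Fin L → ℕ) →
  Injective _≡_ _≡_ v × (∀ i → Adj n (v i) (v (csuc i)))

module Submission where

-- Write k = m + 1 and N = 2m + 1, so the cycle has N + 1 = 2k
-- vertices and n = F(2m+5) - 1.  Define the vertex sequence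
--   c 0 = 1,  c 1 = 2,  c 2 = 6,  c (j+3) = c (j+1) + F (j+5)
-- (1, 2, 6, 7, 14, 20, 35, ...).  By induction on j:
--   * consecutive sums are Fibonacci:  c 0 + c 1 = F 4  and
--     c (j+1) + c (j+2) = F (j+6);
--   * the walk closes up:  c (2m+1) + c 0 = F (2m+4);
--   * c is strictly increasing (hence injective) and c j < F (j+4),
--     so c 0, ..., c N are distinct vertices of {1, ..., n}.

open import Defs
open import Data.Nat using (ℕ; _≤_; _∸_; _*_; _+_)
open import Data.Nat using (zero; suc; _<_; _≤′_; ≤′-refl; ≤′-step; z≤n; s≤s; s≤s⁻¹)
open import Data.Nat.Properties
open import Data.Nat.DivMod using (_%_; m%n<n; n%n≡0; m<n⇒m%n≡m)
open import Data.Fin using (Fin; toℕ)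
open import Data.Fin.Properties using (toℕ-fromℕ<; toℕ-injective; toℕ<n)
open import Data.Product using (_,_)
open import Data.Sum using (inj₁; inj₂)
open import Relation.Binary.PropositionalEquality
open import Relation.Binary using (tri<; tri≈; tri>)
open import Relation.Nullary using (contradiction)
open import Algebra.Properties.CommutativeSemigroup +-commutativeSemigroup
  using (x∙yz≈yx∙z; xy∙z≈xz∙y)

step-≤⇒monotone : (f : ℕ → ℕ) → (∀ j → f j ≤ f (suc j)) →
                  ∀ {i j} → i ≤ j → f i ≤ f j
step-≤⇒monotone f step i≤j = go (≤⇒≤′ i≤j)
  where
  go : ∀ {i j} → i ≤′ j → f i ≤ f j
  go ≤′-refl        = ≤-refl
  go (≤′-step i≤′j) = ≤-trans (go i≤′j) (step _)

step-<⇒strictlyMonotone : (f : ℕ → ℕ) → (∀ j → f j < f (suc j)) →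
                          ∀ {i j} → i < j → f i < f j
step-<⇒strictlyMonotone f step {i} i<j =
  <-≤-trans (step i) (step-≤⇒monotone f (λ j → <⇒≤ (step j)) i<j)

step-<⇒injective : (f : ℕ → ℕ) → (∀ j → f j < f (suc j)) →
                   ∀ {i j} → f i ≡ f j → i ≡ j
step-<⇒injective f step {i} {j} fi≡fj with <-cmp i j
... | tri< i<j _ _ = contradiction fi≡fj (<⇒≢ (step-<⇒strictlyMonotone f step i<j))
... | tri≈ _ i≡j _ = i≡j
... | tri> _ _ j<i = contradiction (sym fi≡fj) (<⇒≢ (step-<⇒strictlyMonotone f step j<i))

fib-step : ∀ j → fib j ≤ fib (suc j)
fib-step zero    = z≤n
fib-step (suc j) = m≤m+n (fib (suc j)) (fib j)

fib-mono : ∀ {i j} → i ≤ j → fib i ≤ fib j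
fib-mono = step-≤⇒monotone fib fib-step

csuc-inner : ∀ {N} (i : Fin (suc N)) → toℕ i < N → toℕ (csuc i) ≡ suc (toℕ i)
csuc-inner {N} i i<N =
  trans (toℕ-fromℕ< (m%n<n (suc (toℕ i)) (suc N))) (m<n⇒m%n≡m (s≤s i<N))

csuc-last : ∀ {N} (i : Fin (suc N)) → toℕ i ≡ N → toℕ (csuc i) ≡ 0
csuc-last {N} i i≡N =
  trans (toℕ-fromℕ< (m%n<n (suc (toℕ i)) (suc N)))
        (subst (λ x → suc x % suc N ≡ 0) (sym i≡N) (n%n≡0 (suc N)))

closedWalk⇒cycle : ∀ {n N} (w : ℕ → ℕ) → 2 ≤ N →
                   (∀ {i j} → w i ≡ w j → i ≡ j) →
                   (∀ j → j ≤ N → IsVertex n (w j)) →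
                   (∀ j → j < N → IsFib (w j + w (suc j))) →
                   IsFib (w N + w 0) →
                   HasCycle n (suc N)
closedWalk⇒cycle {n} {N} w 2≤N w-inj vertex sum-fib closing-fib =
  s≤s 2≤N , v , (λ vi≡vj → toℕ-injective (w-inj vi≡vj)) , adjacent
  where
  v : Fin (suc N) → ℕ
  v i = w (toℕ i)

  distinct : ∀ {i j} → i ≢ j → w i ≢ w j
  distinct i≢j wi≡wj = i≢j (w-inj wi≡wj)

  adjacent : ∀ i → Adj n (v i) (v (csuc i))
  adjacent i with m≤n⇒m<n∨m≡n (s≤s⁻¹ (toℕ<n i))
  ... | inj₁ i<N rewrite csuc-inner i i<N =
    vertex _ (<⇒≤ i<N) , vertex _ i<N , distinct (<⇒≢ (n<1+n _)) , sum-fib _ i<N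
  ... | inj₂ i≡N rewrite csuc-last i i≡N | i≡N =
    vertex N ≤-refl , vertex 0 z≤n ,
    distinct (>⇒≢ (<-≤-trans (s≤s z≤n) 2≤N)) , closing-fib

c : ℕ → ℕ
c zero                = 1
c (suc zero)          = 2
c (suc (suc zero))    = 6
c (suc (suc (suc j))) = c (suc j) + fib (5 + j)

c-consecutive : ∀ j → c (suc j) + c (suc (suc j)) ≡ fib (6 + j)
c-consecutive zero          = refl
c-consecutive (suc zero)    = refl
c-consecutive (suc (suc j)) =
  begin
    c (3 + j) + (c (2 + j) + fib (6 + j))
  ≡⟨ x∙yz≈yx∙z (c (3 + j)) (c (2 + j)) (fib (6 + j)) ⟩
    c (2 + j) + c (3 + j) + fib (6 + j)
  ≡⟨ cong (_+ fib (6 + j)) (c-consecutive (suc j)) ⟩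
    fib (7 + j) + fib (6 + j)
  ∎
  where open ≡-Reasoning

c-sum-fib : ∀ j → IsFib (c j + c (suc j))
c-sum-fib zero    = 4 , refl
c-sum-fib (suc j) = 6 + j , sym (c-consecutive j)

c-closing : ∀ m → c (suc (m + m)) + 1 ≡ fib (4 + (m + m))
c-closing zero    = refl
c-closing (suc m) rewrite +-suc m m =
  begin
    c (suc (m + m)) + fib (5 + (m + m)) + 1
  ≡⟨ xy∙z≈xz∙y (c (suc (m + m))) (fib (5 + (m + m))) 1 ⟩
    c (suc (m + m)) + 1 + fib (5 + (m + m))
  ≡⟨ cong (_+ fib (5 + (m + m))) (c-closing m) ⟩
    fib (4 + (m + m)) + fib (5 + (m + m))
  ≡⟨ +-comm (fib (4 + (m + m))) (fib (5 + (m + m))) ⟩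
    fib (6 + (m + m))
  ∎
  where open ≡-Reasoning

-- c is strictly increasing: each step adds a Fibonacci number to a smaller term.
c-increasing : ∀ j → c j < c (suc j)
c-increasing zero                = s≤s (s≤s z≤n)
c-increasing (suc zero)          = s≤s (s≤s (s≤s z≤n))
c-increasing (suc (suc zero))    = s≤s (s≤s (s≤s (s≤s (s≤s (s≤s (s≤s z≤n))))))
c-increasing (suc (suc (suc j))) = +-mono-<-≤ (c-increasing (suc j)) (fib-step (5 + j))

c-positive : ∀ j → 1 ≤ c j
c-positive j = step-≤⇒monotone c (λ i → <⇒≤ (c-increasing i)) {0} {j} z≤n

c-below-fib : ∀ j → c j < fib (4 + j)
c-below-fib zero                = s≤s (s≤s z≤n)
c-below-fib (suc zero)          = s≤s (s≤s (s≤s z≤n))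
c-below-fib (suc (suc zero))    = s≤s (s≤s (s≤s (s≤s (s≤s (s≤s (s≤s z≤n))))))
c-below-fib (suc (suc (suc j))) =
  +-mono-<-≤ (<-≤-trans (c-below-fib (suc j)) (fib-step (5 + j))) ≤-refl

c-vertex : ∀ {n} N → fib (4 + N) ≤ suc n → ∀ j → j ≤ N → IsVertex n (c j)
c-vertex N fibN≤1+n j j≤N =
  c-positive j , s≤s⁻¹ (<-≤-trans (c-below-fib j) (≤-trans (fib-mono (+-monoʳ-≤ 4 j≤N)) fibN≤1+n))

c-cycle : ∀ m → 1 ≤ m → HasCycle (fib (5 + (m + m)) ∸ 1) (suc (suc (m + m)))
c-cycle m 1≤m =
  closedWalk⇒cycle c (s≤s (≤-trans 1≤m (m≤m+n m m)))
    (step-<⇒injective c c-increasing)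
    (c-vertex (suc (m + m)) (m≤n+m∸n (fib (5 + (m + m))) 1))
    (λ j _ → c-sum-fib j)
    (4 + (m + m) , sym (c-closing m))

theorem9 : (k : ℕ) → 2 ≤ k → HasCycle (fib (2 * k + 3) ∸ 1) (2 * k)
theorem9 (suc m) (s≤s 1≤m) = subst₂ HasCycle order length (c-cycle m 1≤m)
  where
  index : 5 + (m + m) ≡ 2 * suc m + 3
  index rewrite +-identityʳ m | +-suc m m | +-comm (m + m) 3 = refl

  order : fib (5 + (m + m)) ∸ 1 ≡ fib (2 * suc m + 3) ∸ 1
  order = cong (λ i → fib i ∸ 1) index

  length : suc (suc (m + m)) ≡ 2 * suc m
  length rewrite +-identityʳ m | +-suc m m = refl
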